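{- For any spider graph $S_{1,n,n}$ on $2n+1$ vertices with $n\ge 3$, $\gamma_{tc}(M(S_{1,n,n}))=2n+2$.
   Context: All graphs are finite, simple and undirected. The spider graph $S_{1,n,n}$ is obtained from the star $K_{1,n}$ by replacing every edge with a path of length $2$; i.e., it has vertices $v_0,v_1,\dots,v_{2n}$ and edges $v_0v_i$, $v_iv_{n+i}$ for $1\le i\le n$. For a graph $H$, a set $D\subseteq V(H)$ is a total dominating set if every vertex of $H$ has a neighbor in $D$. A set $D\subseteq V(H)$ is a total outer-connected dominating set of $H$ if $D$ is a total dominating set and the induced subgraph $H[V(H)\setminus D]$ is connected; $\gamma_{tc}(H)$ denotes the minimum cardinality of a total outer-connected dominating set of $H$. The middle graph $M(G)$ of a graph $G$ has vertex set $V(G)\cup E(G)$, where two elements $x,y$ are adjacent iff either $x,y\in E(G)$ are edges of $G$ sharing an endpoint, or one of them is a vertex of $G$ and the other is an edge of $G$ incident to it. -}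

module Defs where

open import Data.Nat using (ℕ; suc; _+_; _≤_)
open import Data.Fin using (Fin; zero; suc; _↑ˡ_; _↑ʳ_; splitAt)
open import Data.Fin.Subset using (Subset; _∈_; _∉_; ∣_∣)
open import Data.List using (List; []; _∷_; _++_; map; concatMap; length; lookup)
open import Data.List using () renaming (allFin to allFinL)
open import Data.Product using (_×_; _,_; Σ; ∃; proj₁; proj₂)
open import Data.Sum using (_⊎_; inj₁; inj₂)
open import Data.Empty using (⊥)
open import Relation.Binary.PropositionalEquality using (_≡_; _≢_)

-- A finite (simple) graph given by a vertex count and an adjacency relation
-- on Fin order.  (All graphs below are built from an edge list of a simple
-- graph, so adjacency is symmetric and irreflexive.)
record Graph : Set₁ where
  field
    order : ℕ
    Adj   : Fin order → Fin order → Set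
open Graph public

record EdgeListGraph : Set where
  constructor mkELG
  field
    N     : ℕ
    edges : List (Fin N × Fin N)
open EdgeListGraph public

_incident_ : ∀ {N} → Fin N → Fin N × Fin N → Set
u incident (a , b) = (u ≡ a) ⊎ (u ≡ b)

shareEnd : ∀ {N} → Fin N × Fin N → Fin N × Fin N → Set
shareEnd (a , b) e = (a incident e) ⊎ (b incident e)

toGraph : EdgeListGraph → Graph
toGraph (mkELG N es) = record
  { order = N
  ; Adj   = λ u v → ∃ λ (i : Fin (length es)) →
              (lookup es i ≡ (u , v)) ⊎ (lookup es i ≡ (v , u)) }

-- Middle graph M(G): vertices are V(G) (first N indices) followed by E(G)
-- (remaining length-of-edge-list indices).
middleAdj : (G : EdgeListGraph) → (Fin (N G) ⊎ Fin (length (edges G)))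
          → (Fin (N G) ⊎ Fin (length (edges G))) → Set
middleAdj G (inj₁ u) (inj₁ v) = ⊥
middleAdj G (inj₁ u) (inj₂ e) = u incident lookup (edges G) e
middleAdj G (inj₂ e) (inj₁ u) = u incident lookup (edges G) e
middleAdj G (inj₂ e) (inj₂ f) = (e ≢ f) × shareEnd (lookup (edges G) e) (lookup (edges G) f)

middleGraph : EdgeListGraph → Graph
middleGraph G = record
  { order = N G + length (edges G)
  ; Adj   = λ x y → middleAdj G (splitAt (N G) x) (splitAt (N G) y) }

-- Spider S_{1,n,n}: vertices v0 = zero, v_i = suc (i' ↑ˡ n),
-- v_{n+i} = suc (n ↑ʳ i') for i' : Fin n (i = i' + 1);
-- edges v0 v_i and v_i v_{n+i}.
spider : ℕ → EdgeListGraph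
spider n = mkELG (suc (n + n))
  (concatMap (λ i → (zero , suc (i ↑ˡ n)) ∷ (suc (i ↑ˡ n) , suc (n ↑ʳ i)) ∷ [])
             (allFinL n))

data WalkOutside (H : Graph) (D : Subset (order H)) : Fin (order H) → Fin (order H) → Set where
  here : ∀ {u} → u ∉ D → WalkOutside H D u u
  step : ∀ {u w v} → u ∉ D → Adj H u w → WalkOutside H D w v → WalkOutside H D u v

IsTotalDominating : (H : Graph) → Subset (order H) → Set
IsTotalDominating H D = ∀ v → ∃ λ u → Adj H v u × u ∈ D

ComplementConnected : (H : Graph) → Subset (order H) → Set
ComplementConnected H D = ∀ u v → u ∉ D → v ∉ D → WalkOutside H D u v

IsTotalOuterConnectedDominating : (H : Graph) → Subset (order H) → Set
IsTotalOuterConnectedDominating H D = IsTotalDominating H D × ComplementConnected H D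

γtc≡ : Graph → ℕ → Set
γtc≡ H k = (Σ (Subset (order H)) λ D → IsTotalOuterConnectedDominating H D × ∣ D ∣ ≡ k)
         × (∀ D → IsTotalOuterConnectedDominating H D → k ≤ ∣ D ∣)

-- Write v₀ for the centre, vᵢ, vₙ₊ᵢ for the other vertices of the spider, and in M(S₁,ₙ,ₙ)
-- call the edge v₀vᵢ a spoke and the edge vᵢvₙ₊ᵢ a pendant edge. The leaf vₙ₊ᵢ is adjacent
-- only to its pendant edge, and v₀ only to spokes, so every total dominating set D contains
-- all n pendant edges and some spoke v₀vₖ. If a leaf vₙ₊ᵢ is missing from D, it is an isolated
-- vertex of M − D; the same holds for vₖ if vₖ ∉ D, as both of its neighbours lie in D. Since
-- M − D is connected, it then consists of that vertex alone and |D| = 4n. Otherwise D contains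
-- the n leaves, the n pendant edges, vₖ and v₀vₖ, so |D| ≥ 2n + 2. Conversely the leaves, the
-- pendant edges, v₁ and v₀v₁ form such a set: its complement is a star of paths around v₀.
-- The argument only needs n ≥ 1.
module Submission where

open import Data.Bool using (Bool; true; false)
open import Data.Empty using (⊥-elim)
open import Data.Fin using (Fin; zero; suc; _↑ˡ_; _↑ʳ_; splitAt; join)
open import Data.Fin.Properties
  using (splitAt-↑ˡ; splitAt-↑ʳ; splitAt⁻¹-↑ˡ; splitAt⁻¹-↑ʳ; splitAt-join; join-splitAt;
         ↑ˡ-injective; ↑ʳ-injective; suc-injective; all?; ¬∀⟶∃¬)
open import Data.Fin.Subset using (Subset; _∈_; _∉_; ∣_∣; _⊆_; ∁; ⁅_⁆; _-_)
open import Data.Fin.Subset.Properties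
  using (_∈?_; p⊆q⇒∣p∣≤∣q∣; p⊂q⇒∣p∣<∣q∣; x∈p⇒∣p-x∣<∣p∣; ∣∁p∣≡n∸∣p∣; ∣⁅x⁆∣≡1;
         x∈⁅x⁆; x∈⁅y⁆⇒x≡y; x∈∁p⇒x∉p; x∈p∧x∉q⇒x∈p─q)
open import Data.List using (List; []; _∷_; concatMap; length; lookup)
import Data.List as List
open import Data.Nat using (ℕ; zero; suc; _+_; _*_; _∸_; _≤_; s≤s; s≤s⁻¹)
open import Data.Nat.Properties
  using (≤-reflexive; ≤-trans; +-comm; +-assoc; +-suc; +-monoʳ-≤; m≤n+m∸n; m≤m+n;
         module ≤-Reasoning)
open import Data.Nat.Tactic.RingSolver using (solve-∀)
open import Data.Product using (_×_; _,_; ∃; proj₁; proj₂)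
open import Data.Sum using (_⊎_; inj₁; inj₂; [_,_]′)
open import Data.Vec using (_∷_; []; tabulate)
open import Data.Vec.Properties using (lookup∘tabulate; lookup⇒[]=; []=⇒lookup; tabulate-cong)
open import Function using (_∘_; id)
open import Relation.Nullary using (yes; no)
open import Relation.Binary.PropositionalEquality
  using (_≡_; _≢_; refl; sym; trans; cong; cong₂; subst; subst₂; module ≡-Reasoning)

open import Defs

module _ {H : Graph} {D : Subset (order H)} where

  _++ʷ_ : ∀ {x y z} → WalkOutside H D x y → WalkOutside H D y z → WalkOutside H D x z
  here _         ++ʷ q = q
  step x∉ x∼w p ++ʷ q = step x∉ x∼w (p ++ʷ q)

  walk-start∉ : ∀ {x y} → WalkOutside H D x y → x ∉ D
  walk-start∉ (here x∉)     = x∉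
  walk-start∉ (step x∉ _ _) = x∉

  connected-through : ∀ c → (∀ x → x ∉ D → WalkOutside H D x c × WalkOutside H D c x) →
                      ComplementConnected H D
  connected-through c walks x y x∉ y∉ = proj₁ (walks x x∉) ++ʷ proj₂ (walks y y∉)

  walk-from-isolated : ∀ {x y} → (∀ u → Adj H x u → u ∈ D) → WalkOutside H D x y → y ≡ x
  walk-from-isolated isolated (here _)         = refl
  walk-from-isolated isolated (step _ x∼w w⋯y) = ⊥-elim (walk-start∉ w⋯y (isolated _ x∼w))

  isolated⇒order≤1+∣D∣ : ∀ {x} → ComplementConnected H D → x ∉ D → (∀ u → Adj H x u → u ∈ D) →
                         order H ≤ suc ∣ D ∣
  isolated⇒order≤1+∣D∣ {x} connected x∉D isolated = begin
    order H                   ≤⟨ m≤n+m∸n (order H) ∣ D ∣ ⟩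
    ∣ D ∣ + (order H ∸ ∣ D ∣) ≡⟨ cong (∣ D ∣ +_) (∣∁p∣≡n∸∣p∣ D) ⟨
    ∣ D ∣ + ∣ ∁ D ∣           ≤⟨ +-monoʳ-≤ ∣ D ∣ ∣∁D∣≤1 ⟩
    ∣ D ∣ + 1                 ≡⟨ +-comm ∣ D ∣ 1 ⟩
    suc ∣ D ∣                 ∎
    where
    open ≤-Reasoning
    ∁D⊆⁅x⁆ : ∁ D ⊆ ⁅ x ⁆
    ∁D⊆⁅x⁆ {y} y∈∁D =
      subst (_∈ ⁅ x ⁆) (sym (walk-from-isolated isolated (connected x y x∉D (x∈∁p⇒x∉p y∈∁D))))
            (x∈⁅x⁆ x)
    ∣∁D∣≤1 : ∣ ∁ D ∣ ≤ 1
    ∣∁D∣≤1 = ≤-trans (p⊆q⇒∣p∣≤∣q∣ ∁D⊆⁅x⁆) (≤-reflexive (∣⁅x⁆∣≡1 x))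

shareEnd-sym : ∀ {k} (e f : Fin k × Fin k) → shareEnd e f → shareEnd f e
shareEnd-sym (a , b) (c , d) (inj₁ (inj₁ a≡c)) = inj₁ (inj₁ (sym a≡c))
shareEnd-sym (a , b) (c , d) (inj₁ (inj₂ a≡d)) = inj₂ (inj₁ (sym a≡d))
shareEnd-sym (a , b) (c , d) (inj₂ (inj₁ b≡c)) = inj₁ (inj₂ (sym b≡c))
shareEnd-sym (a , b) (c , d) (inj₂ (inj₂ b≡d)) = inj₂ (inj₂ (sym b≡d))

middleAdj-sym : ∀ G {s t} → middleAdj G s t → middleAdj G t s
middleAdj-sym G {inj₁ u} {inj₂ e} a = a
middleAdj-sym G {inj₂ e} {inj₁ u} a = a
middleAdj-sym G {inj₂ e} {inj₂ f} (e≢f , a) = e≢f ∘ sym , shareEnd-sym _ _ a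

∣tabulate-true∣ : ∀ k → ∣ tabulate {n = k} (λ _ → true) ∣ ≡ k
∣tabulate-true∣ zero    = refl
∣tabulate-true∣ (suc k) = cong suc (∣tabulate-true∣ k)

∣tabulate-false∣ : ∀ k → ∣ tabulate {n = k} (λ _ → false) ∣ ≡ 0
∣tabulate-false∣ zero    = refl
∣tabulate-false∣ (suc k) = ∣tabulate-false∣ k

∣tabulate∣-cong : ∀ {k} {f g : Fin k → Bool} → (∀ i → f i ≡ g i) → ∣ tabulate f ∣ ≡ ∣ tabulate g ∣
∣tabulate∣-cong = cong ∣_∣ ∘ tabulate-cong

module _ {k : ℕ} where

  ∣x∷p∣≡∣x∷[]∣+∣p∣ : ∀ x (p : Subset k) → ∣ x ∷ p ∣ ≡ ∣ x ∷ [] ∣ + ∣ p ∣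
  ∣x∷p∣≡∣x∷[]∣+∣p∣ true  p = refl
  ∣x∷p∣≡∣x∷[]∣+∣p∣ false p = refl

  ∈-tabulate⁺ : ∀ (g : Fin k → Bool) x → g x ≡ true → x ∈ tabulate g
  ∈-tabulate⁺ g x gx = lookup⇒[]= x (tabulate g) (trans (lookup∘tabulate g x) gx)

  ∈-tabulate⁻ : ∀ (g : Fin k → Bool) x → x ∈ tabulate g → g x ≡ true
  ∈-tabulate⁻ g x x∈ = trans (sym (lookup∘tabulate g x)) ([]=⇒lookup x∈)

  2+∣p∣≤∣q∣ : ∀ {p q : Subset k} {x y} → p ⊆ q → x ∈ q → x ∉ p → y ∈ q → y ∉ p → x ≢ y →
              2 + ∣ p ∣ ≤ ∣ q ∣
  2+∣p∣≤∣q∣ {p} {q} {x} {y} p⊆q x∈q x∉p y∈q y∉p x≢y =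
    ≤-trans (s≤s (p⊂q⇒∣p∣<∣q∣ (p⊆q-y , x , ∈q-y x∈q x≢y , x∉p))) (x∈p⇒∣p-x∣<∣p∣ y∈q)
    where
    ∈q-y : ∀ {z} → z ∈ q → z ≢ y → z ∈ q - y
    ∈q-y z∈q z≢y = x∈p∧x∉q⇒x∈p─q z∈q (z≢y ∘ x∈⁅y⁆⇒x≡y y)
    p⊆q-y : p ⊆ q - y
    p⊆q-y z∈p = ∈q-y (p⊆q z∈p) (λ z≡y → y∉p (subst (_∈ p) z≡y z∈p))

∣tabulate∣-↑ : ∀ a {b} (g : Fin (a + b) → Bool) →
               ∣ tabulate g ∣ ≡ ∣ tabulate (g ∘ (_↑ˡ b)) ∣ + ∣ tabulate (g ∘ (a ↑ʳ_)) ∣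
∣tabulate∣-↑ zero        g = refl
∣tabulate∣-↑ (suc a) {b} g = begin
  ∣ g zero ∷ tail ∣                 ≡⟨ ∣x∷p∣≡∣x∷[]∣+∣p∣ (g zero) tail ⟩
  h + ∣ tail ∣                      ≡⟨ cong (h +_) (∣tabulate∣-↑ a (λ i → g (suc i))) ⟩
  h + (∣ left ∣ + ∣ right ∣)        ≡⟨ +-assoc h (∣ left ∣) (∣ right ∣) ⟨
  h + ∣ left ∣ + ∣ right ∣          ≡⟨ cong (_+ ∣ right ∣) (∣x∷p∣≡∣x∷[]∣+∣p∣ (g zero) left) ⟨
  ∣ g zero ∷ left ∣ + ∣ right ∣     ∎
  where
  open ≡-Reasoning
  h : ℕ
  h = ∣ g zero ∷ [] ∣
  tail : Subset (a + b)
  tail = tabulate (λ i → g (suc i))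
  left : Subset a
  left = tabulate (λ i → g (suc (i ↑ˡ b)))
  right : Subset b
  right = tabulate (λ i → g (suc a ↑ʳ i))

module MiddleSpider (m : ℕ) where

  n : ℕ
  n = suc m

  #V : ℕ
  #V = suc (n + n)

  v₀ : Fin #V
  v₀ = zero

  vᵢ vₙ₊ᵢ : Fin n → Fin #V
  vᵢ i   = suc (i ↑ˡ n)
  vₙ₊ᵢ i = suc (n ↑ʳ i)

  vᵢ≢vₙ₊ᵢ : ∀ i j → vᵢ i ≢ vₙ₊ᵢ j
  vᵢ≢vₙ₊ᵢ i j eq
    with trans (sym (splitAt-↑ˡ n i n))
               (trans (cong (splitAt n) (suc-injective eq)) (splitAt-↑ʳ n n j))
  ... | ()

  vᵢ-injective : ∀ {i j} → vᵢ i ≡ vᵢ j → i ≡ j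
  vᵢ-injective {i} {j} = ↑ˡ-injective n i j ∘ suc-injective

  vₙ₊ᵢ-injective : ∀ {i j} → vₙ₊ᵢ i ≡ vₙ₊ᵢ j → i ≡ j
  vₙ₊ᵢ-injective {i} {j} = ↑ʳ-injective n i j ∘ suc-injective

  -- The edge list of the spider is edgesFrom id; generalising id to F makes recursion possible.
  legEdges : Fin n → List (Fin #V × Fin #V)
  legEdges i = (v₀ , vᵢ i) ∷ (vᵢ i , vₙ₊ᵢ i) ∷ []

  edgesFrom : ∀ {k} → (Fin k → Fin n) → List (Fin #V × Fin #V)
  edgesFrom F = concatMap legEdges (List.tabulate F)

  spokeIdx pendantIdx : ∀ {k} (F : Fin k → Fin n) → Fin k → Fin (length (edgesFrom F))
  spokeIdx   F zero    = zero
  spokeIdx   F (suc j) = suc (suc (spokeIdx (F ∘ suc) j))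
  pendantIdx F zero    = suc zero
  pendantIdx F (suc j) = suc (suc (pendantIdx (F ∘ suc) j))

  lookup-spokeIdx : ∀ {k} (F : Fin k → Fin n) j →
                    lookup (edgesFrom F) (spokeIdx F j) ≡ (v₀ , vᵢ (F j))
  lookup-spokeIdx F zero    = refl
  lookup-spokeIdx F (suc j) = lookup-spokeIdx (F ∘ suc) j

  lookup-pendantIdx : ∀ {k} (F : Fin k → Fin n) j →
                      lookup (edgesFrom F) (pendantIdx F j) ≡ (vᵢ (F j) , vₙ₊ᵢ (F j))
  lookup-pendantIdx F zero    = refl
  lookup-pendantIdx F (suc j) = lookup-pendantIdx (F ∘ suc) j

  spokeIdx≢pendantIdx : ∀ {k} (F : Fin k → Fin n) j → spokeIdx F j ≢ pendantIdx F j
  spokeIdx≢pendantIdx F zero    ()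
  spokeIdx≢pendantIdx F (suc j) eq =
    spokeIdx≢pendantIdx (F ∘ suc) j (suc-injective (suc-injective eq))

  edgeIdx-cases : ∀ {k} (F : Fin k → Fin n) e →
                  (∃ λ j → e ≡ spokeIdx F j) ⊎ (∃ λ j → e ≡ pendantIdx F j)
  edgeIdx-cases {suc k} F zero          = inj₁ (zero , refl)
  edgeIdx-cases {suc k} F (suc zero)    = inj₂ (zero , refl)
  edgeIdx-cases {suc k} F (suc (suc e)) with edgeIdx-cases (F ∘ suc) e
  ... | inj₁ (j , refl) = inj₁ (suc j , refl)
  ... | inj₂ (j , refl) = inj₂ (suc j , refl)

  length-edgesFrom : ∀ {k} (F : Fin k → Fin n) → length (edgesFrom F) ≡ k + k
  length-edgesFrom {zero}  F = refl
  length-edgesFrom {suc k} F =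
    cong suc (trans (cong suc (length-edgesFrom (F ∘ suc))) (sym (+-suc k k)))

  ∣tabulate∣-edges : ∀ {k} (F : Fin k → Fin n) (g : Fin (length (edgesFrom F)) → Bool) →
    ∣ tabulate g ∣ ≡ ∣ tabulate (g ∘ spokeIdx F) ∣ + ∣ tabulate (g ∘ pendantIdx F) ∣
  ∣tabulate∣-edges {zero}  F g = refl
  ∣tabulate∣-edges {suc k} F g = begin
    ∣ s₀ ∷ p₀ ∷ rest ∣             ≡⟨ ∣x∷p∣≡∣x∷[]∣+∣p∣ s₀ (p₀ ∷ rest) ⟩
    S + ∣ p₀ ∷ rest ∣              ≡⟨ cong (S +_) (∣x∷p∣≡∣x∷[]∣+∣p∣ p₀ rest) ⟩
    S + (P + ∣ rest ∣)
      ≡⟨ cong (λ r → S + (P + r)) (∣tabulate∣-edges (λ j → F (suc j)) g′) ⟩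
    S + (P + (∣ spokes ∣ + ∣ pendants ∣))
      ≡⟨ interchange S P ∣ spokes ∣ ∣ pendants ∣ ⟩
    (S + ∣ spokes ∣) + (P + ∣ pendants ∣)
      ≡⟨ cong₂ _+_ (∣x∷p∣≡∣x∷[]∣+∣p∣ s₀ spokes) (∣x∷p∣≡∣x∷[]∣+∣p∣ p₀ pendants) ⟨
    ∣ tabulate (g ∘ spokeIdx F) ∣ + ∣ tabulate (g ∘ pendantIdx F) ∣ ∎
    where
    open ≡-Reasoning
    s₀ p₀ : Bool
    s₀ = g zero
    p₀ = g (suc zero)
    g′ : Fin (length (edgesFrom (λ j → F (suc j)))) → Bool
    g′ e = g (suc (suc e))
    rest : Subset (length (edgesFrom (λ j → F (suc j))))
    rest = tabulate g′
    spokes pendants : Subset k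
    spokes   = tabulate (g′ ∘ spokeIdx (λ j → F (suc j)))
    pendants = tabulate (g′ ∘ pendantIdx (λ j → F (suc j)))
    S P : ℕ
    S = ∣ s₀ ∷ [] ∣
    P = ∣ p₀ ∷ [] ∣
    interchange : ∀ a b c d → a + (b + (c + d)) ≡ (a + c) + (b + d)
    interchange = solve-∀

  G : EdgeListGraph
  G = spider n

  H : Graph
  H = middleGraph G

  #E : ℕ
  #E = length (edges G)

  data Vertex : Set where
    centre        : Vertex
    inner leaf    : Fin n → Vertex
    spoke pendant : Fin n → Vertex

  place : Vertex → Fin #V ⊎ Fin #E
  place centre      = inj₁ v₀
  place (inner i)   = inj₁ (vᵢ i)
  place (leaf i)    = inj₁ (vₙ₊ᵢ i)
  place (spoke i)   = inj₂ (spokeIdx id i)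
  place (pendant i) = inj₂ (pendantIdx id i)

  decodeEdge : ∀ {k} (F : Fin k → Fin n) → Fin (length (edgesFrom F)) → Vertex
  decodeEdge {suc k} F zero          = spoke (F zero)
  decodeEdge {suc k} F (suc zero)    = pendant (F zero)
  decodeEdge {suc k} F (suc (suc e)) = decodeEdge (F ∘ suc) e

  decodeEdge-spokeIdx : ∀ {k} (F : Fin k → Fin n) j → decodeEdge F (spokeIdx F j) ≡ spoke (F j)
  decodeEdge-spokeIdx F zero    = refl
  decodeEdge-spokeIdx F (suc j) = decodeEdge-spokeIdx (F ∘ suc) j

  decodeEdge-pendantIdx : ∀ {k} (F : Fin k → Fin n) j →
                          decodeEdge F (pendantIdx F j) ≡ pendant (F j)
  decodeEdge-pendantIdx F zero    = refl
  decodeEdge-pendantIdx F (suc j) = decodeEdge-pendantIdx (F ∘ suc) j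

  decodeVertex : Fin #V → Vertex
  decodeVertex zero    = centre
  decodeVertex (suc w) = [ inner , leaf ]′ (splitAt n w)

  unplace : Fin #V ⊎ Fin #E → Vertex
  unplace = [ decodeVertex , decodeEdge id ]′

  unplace-place : ∀ v → unplace (place v) ≡ v
  unplace-place centre      = refl
  unplace-place (inner i)   = cong [ inner , leaf ]′ (splitAt-↑ˡ n i n)
  unplace-place (leaf i)    = cong [ inner , leaf ]′ (splitAt-↑ʳ n n i)
  unplace-place (spoke i)   = decodeEdge-spokeIdx id i
  unplace-place (pendant i) = decodeEdge-pendantIdx id i

  place-unplace : ∀ s → place (unplace s) ≡ s
  place-unplace (inj₁ zero)    = refl
  place-unplace (inj₁ (suc w)) with splitAt n w in eq
  ... | inj₁ i = cong (inj₁ ∘ suc) (splitAt⁻¹-↑ˡ eq)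
  ... | inj₂ i = cong (inj₁ ∘ suc) (splitAt⁻¹-↑ʳ eq)
  place-unplace (inj₂ e) with edgeIdx-cases id e
  ... | inj₁ (j , refl) = cong place (decodeEdge-spokeIdx id j)
  ... | inj₂ (j , refl) = cong place (decodeEdge-pendantIdx id j)

  ⌜_⌝ : Vertex → Fin (order H)
  ⌜ v ⌝ = join #V #E (place v)

  decode : Fin (order H) → Vertex
  decode x = unplace (splitAt #V x)

  decode-⌜⌝ : ∀ v → decode ⌜ v ⌝ ≡ v
  decode-⌜⌝ v = trans (cong unplace (splitAt-join #V #E (place v))) (unplace-place v)

  ⌜⌝-decode : ∀ x → ⌜ decode x ⌝ ≡ x
  ⌜⌝-decode x = trans (cong (join #V #E) (place-unplace (splitAt #V x))) (join-splitAt #V #E x)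

  ⌜⌝-elim : ∀ {ℓ} (Q : Fin (order H) → Set ℓ) → (∀ v → Q ⌜ v ⌝) → ∀ x → Q x
  ⌜⌝-elim Q q x = subst Q (⌜⌝-decode x) (q (decode x))

  -- A record, so that v and w can be inferred from an adjacency proof.
  record _∼_ (v w : Vertex) : Set where
    constructor adjacent
    field adjacency : middleAdj G (place v) (place w)

  ∼-sym : ∀ {v w} → v ∼ w → w ∼ v
  ∼-sym (adjacent a) = adjacent (middleAdj-sym G a)

  ∼⇒Adj : ∀ {v w} → v ∼ w → Adj H ⌜ v ⌝ ⌜ w ⌝
  ∼⇒Adj {v} {w} (adjacent a) =
    subst₂ (middleAdj G) (sym (splitAt-join #V #E (place v))) (sym (splitAt-join #V #E (place w))) a

  Adj⇒∼ : ∀ v x → Adj H ⌜ v ⌝ x → v ∼ decode x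
  Adj⇒∼ v x a =
    adjacent (subst₂ (middleAdj G) (splitAt-join #V #E (place v))
                                   (sym (place-unplace (splitAt #V x))) a)

  centre∼spoke : ∀ i → centre ∼ spoke i
  centre∼spoke i = adjacent (subst (v₀ incident_) (sym (lookup-spokeIdx id i)) (inj₁ refl))

  inner∼spoke : ∀ i → inner i ∼ spoke i
  inner∼spoke i = adjacent (subst (vᵢ i incident_) (sym (lookup-spokeIdx id i)) (inj₂ refl))

  inner∼pendant : ∀ i → inner i ∼ pendant i
  inner∼pendant i = adjacent (subst (vᵢ i incident_) (sym (lookup-pendantIdx id i)) (inj₁ refl))

  leaf∼pendant : ∀ i → leaf i ∼ pendant i
  leaf∼pendant i = adjacent (subst (vₙ₊ᵢ i incident_) (sym (lookup-pendantIdx id i)) (inj₂ refl))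

  spoke∼pendant : ∀ i → spoke i ∼ pendant i
  spoke∼pendant i = adjacent (spokeIdx≢pendantIdx id i ,
    subst₂ shareEnd (sym (lookup-spokeIdx id i)) (sym (lookup-pendantIdx id i)) (inj₂ (inj₁ refl)))

  centre-neighbour : ∀ {w} → centre ∼ w → ∃ λ k → w ≡ spoke k
  centre-neighbour {spoke k}   _ = k , refl
  centre-neighbour {pendant k} (adjacent a) with subst (v₀ incident_) (lookup-pendantIdx id k) a
  ... | inj₁ ()
  ... | inj₂ ()

  inner-neighbour : ∀ {k w} → inner k ∼ w → w ≡ spoke k ⊎ w ≡ pendant k
  inner-neighbour {k} {spoke j} (adjacent a) with subst (vᵢ k incident_) (lookup-spokeIdx id j) a
  ... | inj₂ eq = inj₁ (cong spoke (sym (vᵢ-injective eq)))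
  inner-neighbour {k} {pendant j} (adjacent a)
    with subst (vᵢ k incident_) (lookup-pendantIdx id j) a
  ... | inj₁ eq = inj₂ (cong pendant (sym (vᵢ-injective eq)))
  ... | inj₂ eq = ⊥-elim (vᵢ≢vₙ₊ᵢ k j eq)

  leaf-neighbour : ∀ {k w} → leaf k ∼ w → w ≡ pendant k
  leaf-neighbour {k} {spoke j} (adjacent a) with subst (vₙ₊ᵢ k incident_) (lookup-spokeIdx id j) a
  ... | inj₂ eq = ⊥-elim (vᵢ≢vₙ₊ᵢ j k (sym eq))
  leaf-neighbour {k} {pendant j} (adjacent a)
    with subst (vₙ₊ᵢ k incident_) (lookup-pendantIdx id j) a
  ... | inj₁ eq = ⊥-elim (vᵢ≢vₙ₊ᵢ j k (sym eq))
  ... | inj₂ eq = cong pendant (sym (vₙ₊ᵢ-injective eq))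

  order-H : order H ≡ #V + (n + n)
  order-H = cong (#V +_) (length-edgesFrom id)

  ∣tabulate∣-by-kind : (g : Fin (order H) → Bool) →
    ∣ tabulate g ∣ ≡ ∣ g ⌜ centre ⌝ ∷ [] ∣
                     + (∣ tabulate (g ∘ ⌜_⌝ ∘ inner) ∣ + ∣ tabulate (g ∘ ⌜_⌝ ∘ leaf) ∣)
                     + (∣ tabulate (g ∘ ⌜_⌝ ∘ spoke) ∣ + ∣ tabulate (g ∘ ⌜_⌝ ∘ pendant) ∣)
  ∣tabulate∣-by-kind g =
    trans (∣tabulate∣-↑ #V g) (cong₂ _+_ vertices (∣tabulate∣-edges id (g ∘ (#V ↑ʳ_))))
    where
    vertices : ∣ tabulate (g ∘ (_↑ˡ #E)) ∣
             ≡ ∣ g ⌜ centre ⌝ ∷ [] ∣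
               + (∣ tabulate (g ∘ ⌜_⌝ ∘ inner) ∣ + ∣ tabulate (g ∘ ⌜_⌝ ∘ leaf) ∣)
    vertices = trans (∣x∷p∣≡∣x∷[]∣+∣p∣ (g ⌜ centre ⌝) (tabulate g′))
                     (cong (∣ g ⌜ centre ⌝ ∷ [] ∣ +_) (∣tabulate∣-↑ n g′))
      where g′ : Fin (n + n) → Bool
            g′ w = g (suc w ↑ˡ #E)

  ⟦_⟧ : (Vertex → Bool) → Subset (order H)
  ⟦ P ⟧ = tabulate (P ∘ decode)

  module _ (P : Vertex → Bool) where

    ∈⟦⟧ : ∀ v → P v ≡ true → ⌜ v ⌝ ∈ ⟦ P ⟧
    ∈⟦⟧ v Pv = ∈-tabulate⁺ (P ∘ decode) ⌜ v ⌝ (trans (cong P (decode-⌜⌝ v)) Pv)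

    ∉⟦⟧ : ∀ v → P v ≡ false → ⌜ v ⌝ ∉ ⟦ P ⟧
    ∉⟦⟧ v Pv v∈
      with trans (sym Pv) (trans (cong P (sym (decode-⌜⌝ v))) (∈-tabulate⁻ (P ∘ decode) ⌜ v ⌝ v∈))
    ... | ()

    ∉⟦⟧⁻ : ∀ v → ⌜ v ⌝ ∉ ⟦ P ⟧ → P v ≡ false
    ∉⟦⟧⁻ v v∉ with P v in Pv
    ... | true  = ⊥-elim (v∉ (∈⟦⟧ v Pv))
    ... | false = refl

    ⟦⟧⊆ : ∀ {D} → (∀ v → P v ≡ true → ⌜ v ⌝ ∈ D) → ⟦ P ⟧ ⊆ D
    ⟦⟧⊆ {D} inD {x} x∈ =
      subst (_∈ D) (⌜⌝-decode x) (inD (decode x) (∈-tabulate⁻ (P ∘ decode) x x∈))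

    ⟦⟧-dominating : (∀ v → ∃ λ w → v ∼ w × P w ≡ true) → IsTotalDominating H ⟦ P ⟧
    ⟦⟧-dominating dom = ⌜⌝-elim (λ x → ∃ λ u → Adj H x u × u ∈ ⟦ P ⟧) λ v →
      let (w , v∼w , Pw) = dom v in ⌜ w ⌝ , ∼⇒Adj v∼w , ∈⟦⟧ w Pw

    ∣⟦⟧∣ : ∣ ⟦ P ⟧ ∣ ≡ ∣ P centre ∷ [] ∣ + (∣ tabulate (P ∘ inner) ∣ + ∣ tabulate (P ∘ leaf) ∣)
                                       + (∣ tabulate (P ∘ spoke) ∣ + ∣ tabulate (P ∘ pendant) ∣)
    ∣⟦⟧∣ = trans (∣tabulate∣-by-kind (P ∘ decode))
      (cong₂ _+_ (cong (∣ P centre ∷ [] ∣ +_) (cong₂ _+_ (decoded inner) (decoded leaf)))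
                 (cong₂ _+_ (decoded spoke) (decoded pendant)))
      where
      decoded : (f : Fin n → Vertex) → ∣ tabulate (P ∘ decode ∘ ⌜_⌝ ∘ f) ∣ ≡ ∣ tabulate (P ∘ f) ∣
      decoded f = ∣tabulate∣-cong (λ i → cong P (decode-⌜⌝ (f i)))

  -- A total outer-connected dominating set of size 2n + 2

  inD₀ : Vertex → Bool
  inD₀ centre            = false
  inD₀ (inner zero)      = true
  inD₀ (inner (suc _))   = false
  inD₀ (leaf _)          = true
  inD₀ (spoke zero)      = true
  inD₀ (spoke (suc _))   = false
  inD₀ (pendant _)       = true

  D₀ : Subset (order H)
  D₀ = ⟦ inD₀ ⟧

  D₀-dominator : ∀ v → ∃ λ w → v ∼ w × inD₀ w ≡ true
  D₀-dominator centre      = spoke zero , centre∼spoke zero , refl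
  D₀-dominator (inner i)   = pendant i , inner∼pendant i , refl
  D₀-dominator (leaf i)    = pendant i , leaf∼pendant i , refl
  D₀-dominator (spoke i)   = pendant i , spoke∼pendant i , refl
  D₀-dominator (pendant i) = leaf i , ∼-sym (leaf∼pendant i) , refl

  ∉D₀ : ∀ v → inD₀ v ≡ false → ⌜ v ⌝ ∉ D₀
  ∉D₀ = ∉⟦⟧ inD₀

  walk-to-centre : ∀ v → inD₀ v ≡ false → WalkOutside H D₀ ⌜ v ⌝ ⌜ centre ⌝
  walk-to-centre centre          _ = here (∉D₀ centre refl)
  walk-to-centre (inner (suc i)) _ =
    step (∉D₀ (inner (suc i)) refl) (∼⇒Adj (inner∼spoke (suc i)))
      (walk-to-centre (spoke (suc i)) refl)
  walk-to-centre (spoke (suc i)) _ =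
    step (∉D₀ (spoke (suc i)) refl) (∼⇒Adj (∼-sym (centre∼spoke (suc i)))) (here (∉D₀ centre refl))
  walk-to-centre (inner zero)    ()
  walk-to-centre (leaf _)        ()
  walk-to-centre (spoke zero)    ()
  walk-to-centre (pendant _)     ()

  walk-from-centre : ∀ v → inD₀ v ≡ false → WalkOutside H D₀ ⌜ centre ⌝ ⌜ v ⌝
  walk-from-centre centre          _ = here (∉D₀ centre refl)
  walk-from-centre (inner (suc i)) _ =
    step (∉D₀ centre refl) (∼⇒Adj (centre∼spoke (suc i)))
      (step (∉D₀ (spoke (suc i)) refl) (∼⇒Adj (∼-sym (inner∼spoke (suc i))))
        (here (∉D₀ (inner (suc i)) refl)))
  walk-from-centre (spoke (suc i)) _ =
    step (∉D₀ centre refl) (∼⇒Adj (centre∼spoke (suc i))) (here (∉D₀ (spoke (suc i)) refl))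
  walk-from-centre (inner zero)    ()
  walk-from-centre (leaf _)        ()
  walk-from-centre (spoke zero)    ()
  walk-from-centre (pendant _)     ()

  D₀-isTOCD : IsTotalOuterConnectedDominating H D₀
  D₀-isTOCD = ⟦⟧-dominating inD₀ D₀-dominator , connected-through ⌜ centre ⌝
    (⌜⌝-elim (λ x → x ∉ D₀ → WalkOutside H D₀ x ⌜ centre ⌝ × WalkOutside H D₀ ⌜ centre ⌝ x) λ v v∉ →
      walk-to-centre v (∉⟦⟧⁻ inD₀ v v∉) , walk-from-centre v (∉⟦⟧⁻ inD₀ v v∉))

  ∣D₀∣ : ∣ D₀ ∣ ≡ 2 * n + 2
  ∣D₀∣ = begin
    ∣ D₀ ∣                               ≡⟨ ∣⟦⟧∣ inD₀ ⟩
    0 + (suc #F + #T) + (suc #F + #T)    ≡⟨ cong₂ (λ f t → 0 + (suc f + t) + (suc f + t))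
                                                  (∣tabulate-false∣ m) (∣tabulate-true∣ n) ⟩
    0 + (1 + n) + (1 + n)                ≡⟨ arith n ⟩
    2 * n + 2                            ∎
    where
    open ≡-Reasoning
    #F #T : ℕ
    #F = ∣ tabulate {n = m} (λ _ → false) ∣
    #T = ∣ tabulate {n = n} (λ _ → true) ∣
    arith : ∀ a → 0 + (1 + a) + (1 + a) ≡ 2 * a + 2
    arith = solve-∀

  -- Every total outer-connected dominating set has at least 2n + 2 elements

  inS : Vertex → Bool
  inS (leaf _)    = true
  inS (pendant _) = true
  inS _           = false

  ∣⟦inS⟧∣ : ∣ ⟦ inS ⟧ ∣ ≡ n + n
  ∣⟦inS⟧∣ = begin
    ∣ ⟦ inS ⟧ ∣                   ≡⟨ ∣⟦⟧∣ inS ⟩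
    0 + (#F + #T) + (#F + #T)     ≡⟨ cong₂ (λ f t → 0 + (f + t) + (f + t))
                                           (∣tabulate-false∣ n) (∣tabulate-true∣ n) ⟩
    n + n                         ∎
    where
    open ≡-Reasoning
    #F #T : ℕ
    #F = ∣ tabulate {n = n} (λ _ → false) ∣
    #T = ∣ tabulate {n = n} (λ _ → true) ∣

  2n+2≤4n : 2 * n + 2 ≤ (n + n) + (n + n)
  2n+2≤4n = ≤-trans (m≤m+n (2 * n + 2) (m + m)) (≤-reflexive (arith m))
    where arith : ∀ a → 2 * suc a + 2 + (a + a) ≡ (suc a + suc a) + (suc a + suc a)
          arith = solve-∀

  module _ (D : Subset (order H)) (tocd : IsTotalOuterConnectedDominating H D) where

    dominator : ∀ v → ∃ λ w → v ∼ w × ⌜ w ⌝ ∈ D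
    dominator v with proj₁ tocd ⌜ v ⌝
    ... | x , v∼x , x∈D = decode x , Adj⇒∼ v x v∼x , subst (_∈ D) (sym (⌜⌝-decode x)) x∈D

    pendant∈D : ∀ i → ⌜ pendant i ⌝ ∈ D
    pendant∈D i with dominator (leaf i)
    ... | w , leaf∼w , w∈D with leaf-neighbour leaf∼w
    ...   | refl = w∈D

    some-spoke∈D : ∃ λ k → ⌜ spoke k ⌝ ∈ D
    some-spoke∈D with dominator centre
    ... | w , centre∼w , w∈D with centre-neighbour centre∼w
    ...   | k , refl = k , w∈D

    isolated-bound : ∀ v → ⌜ v ⌝ ∉ D → (∀ w → v ∼ w → ⌜ w ⌝ ∈ D) → 2 * n + 2 ≤ ∣ D ∣
    isolated-bound v v∉D isolated = ≤-trans 2n+2≤4n (s≤s⁻¹ (subst (_≤ suc ∣ D ∣) order-H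
      (isolated⇒order≤1+∣D∣ (proj₂ tocd) v∉D λ x v∼x →
        subst (_∈ D) (⌜⌝-decode x) (isolated (decode x) (Adj⇒∼ v x v∼x)))))

    lower-bound : 2 * n + 2 ≤ ∣ D ∣
    lower-bound with all? (λ i → ⌜ leaf i ⌝ ∈? D)
    ... | no ¬leaves∈D with ¬∀⟶∃¬ n _ (λ i → ⌜ leaf i ⌝ ∈? D) ¬leaves∈D
    ...   | i , leaf∉D = isolated-bound (leaf i) leaf∉D λ w leaf∼w →
              subst (λ u → ⌜ u ⌝ ∈ D) (sym (leaf-neighbour leaf∼w)) (pendant∈D i)
    lower-bound | yes leaves∈D with some-spoke∈D
    ... | k , spoke∈D with ⌜ inner k ⌝ ∈? D
    ...   | no inner∉D = isolated-bound (inner k) inner∉D λ w inner∼w →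
              [ (λ { refl → spoke∈D }) , (λ { refl → pendant∈D k }) ]′ (inner-neighbour inner∼w)
    ...   | yes inner∈D = begin
      2 * n + 2         ≡⟨ arith n ⟩
      2 + (n + n)       ≡⟨ cong (2 +_) ∣⟦inS⟧∣ ⟨
      2 + ∣ ⟦ inS ⟧ ∣   ≤⟨ 2+∣p∣≤∣q∣ S⊆D inner∈D (∉⟦⟧ inS (inner k) refl)
                                     spoke∈D (∉⟦⟧ inS (spoke k) refl) inner≢spoke ⟩
      ∣ D ∣             ∎
      where
      open ≤-Reasoning
      arith : ∀ a → 2 * a + 2 ≡ 2 + (a + a)
      arith = solve-∀
      S⊆D : ⟦ inS ⟧ ⊆ D
      S⊆D = ⟦⟧⊆ inS λ { (leaf i) _ → leaves∈D i ; (pendant i) _ → pendant∈D i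
                  ; centre () ; (inner _) () ; (spoke _) () }
      inner≢spoke : ⌜ inner k ⌝ ≢ ⌜ spoke k ⌝
      inner≢spoke eq
        with trans (sym (decode-⌜⌝ (inner k))) (trans (cong decode eq) (decode-⌜⌝ (spoke k)))
      ... | ()

  γtc≡2n+2 : γtc≡ H (2 * n + 2)
  γtc≡2n+2 = (D₀ , D₀-isTOCD , ∣D₀∣) , lower-bound

theorem4p8 : (n : ℕ) → 3 ≤ n → γtc≡ (middleGraph (spider n)) (2 * n + 2)
theorem4p8 (suc m) _ = MiddleSpider.γtc≡2n+2 m
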